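{- Let $p\ge1$ and let $t:A^{p^2}\to B$ be a doubly cyclic function. Define $t^\sigma:A^{p^2}\to B$ by $t^\sigma(y_1,\dots,y_{p^2})=t(z_1,\dots,z_{p^2})$, where $z_{(j-1)p+i}=y_{(i-1)p+j}$ for all $i,j\in[p]$ (i.e., if the arguments of $t^\sigma$ are arranged row-wise into a $p\times p$ matrix, $t$ is applied to the arguments read column-wise). Then $t^\sigma$ is cyclic, i.e., $t^\sigma(y_1,y_2,\dots,y_{p^2})=t^\sigma(y_2,\dots,y_{p^2},y_1)$ for all $y_1,\dots,y_{p^2}\in A$.
   Context: A function $t:A^{p^2}\to B$, with its argument list written as $p$ consecutive blocks $\mathbf x_1,\dots,\mathbf x_p$ of length $p$, is doubly cyclic if (a) $t(\mathbf x_1,\dots,\mathbf x_p)=t(\mathbf y_1,\dots,\mathbf y_p)$ whenever each $\mathbf y_i$ is a cyclic shift of $\mathbf x_i$ (shifts chosen independently for each $i$), for all values of the entries, and (b) $t(\mathbf x_1,\mathbf x_2,\dots,\mathbf x_p)=t(\mathbf x_2,\dots,\mathbf x_p,\mathbf x_1)$ for all $\mathbf x_1,\dots,\mathbf x_p\in A^p$. A cyclic shift of $(x_1,\dots,x_m)$ is any tuple $(x_{i+1},\dots,x_m,x_1,\dots,x_i)$, $0\le i<m$. -}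

module Defs where

open import Level using (Level)
open import Data.Nat using (ℕ; zero; suc; _*_)
open import Data.Vec using (Vec; []; _∷_; _∷ʳ_; concat; zipWith; group; transpose)
open import Data.Product using (proj₁; _×_)
open import Relation.Binary.PropositionalEquality using (_≡_)

private
  variable
    a b : Level
    A : Set a
    B : Set b
    n : ℕ

shift1 : Vec A n → Vec A n
shift1 []       = []
shift1 (x ∷ xs) = xs ∷ʳ x

shift : ℕ → Vec A n → Vec A n
shift zero    xs = xs
shift (suc i) xs = shift i (shift1 xs)

DoublyCyclic : (p : ℕ) → (Vec A (p * p) → B) → Set _
DoublyCyclic {A = A} p t =
  (∀ (xs : Vec (Vec A p) p) (is : Vec ℕ p) →
     t (concat xs) ≡ t (concat (zipWith shift is xs)))
  × (∀ (xs : Vec (Vec A p) p) → t (concat xs) ≡ t (concat (shift1 xs)))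

Cyclic : (m : ℕ) → (Vec A m → B) → Set _
Cyclic {A = A} m f = ∀ (ys : Vec A m) → f ys ≡ f (shift1 ys)

tσ : (p : ℕ) → (Vec A (p * p) → B) → Vec A (p * p) → B
tσ p t ys = t (concat (transpose (proj₁ (group p p ys))))

-- Arrange the arguments of t^σ row-wise as a p×p matrix with first column c and
-- remaining columns R. A left shift of the arguments moves each row one place left and
-- fills the freed last column with the first column shifted up by one, so the column
-- reading changes from (c, R) to (R, shift1 c). The two symmetries of t bridge this:
-- rotate the block c on its own, then rotate the blocks.
module Submission where

open import Defs
open import Level using (Level)
open import Data.Nat using (ℕ; _≤_; _*_; suc; s≤s)
open import Data.Vec using (Vec; []; _∷_; _∷ʳ_; _++_; concat; zipWith; group; transpose; map; head; tail; replicate; _⊛_)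
open import Data.Vec.Properties using (++-injectiveˡ; ++-injectiveʳ)
open import Function using (_∘_)
open import Data.Product using (∃₂; proj₁; proj₂; _,_)
open import Relation.Binary.PropositionalEquality

private
  variable
    a b : Level
    A : Set a
    B : Set b
    k m n : ℕ

concat-injective : (xss yss : Vec (Vec A m) n) → concat xss ≡ concat yss → xss ≡ yss
concat-injective []         []         _  = refl
concat-injective (xs ∷ xss) (ys ∷ yss) eq =
  cong₂ _∷_ (++-injectiveˡ xs ys eq) (concat-injective xss yss (++-injectiveʳ xs ys eq))

group-concat : (xss : Vec (Vec A m) n) → proj₁ (group n m (concat xss)) ≡ xss
group-concat {m = m} {n = n} xss =
  sym (concat-injective xss _ (proj₂ (group n m (concat xss))))

zipWith-∷-head-tail : (xss : Vec (Vec A (suc m)) n) → zipWith _∷_ (map head xss) (map tail xss) ≡ xss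
zipWith-∷-head-tail []                = refl
zipWith-∷-head-tail ((x ∷ xs) ∷ xss) = cong ((x ∷ xs) ∷_) (zipWith-∷-head-tail xss)

split-first-column : (xs : Vec A (n * suc m)) →
                     ∃₂ λ (c : Vec A n) (R : Vec (Vec A m) n) → xs ≡ concat (zipWith _∷_ c R)
split-first-column {n = n} {m = m} xs =
  let xss , xs≡ = group n (suc m) xs in
  map head xss , map tail xss , trans xs≡ (cong concat (sym (zipWith-∷-head-tail xss)))

++-∷ʳ-slide : (xs : Vec A k) {ys zs : Vec A m} {y z : A} →
              ys ∷ʳ z ≡ y ∷ zs → (xs ++ ys) ∷ʳ z ≡ (xs ∷ʳ y) ++ zs
++-∷ʳ-slide []       eq = eq
++-∷ʳ-slide (x ∷ xs) eq = cong (x ∷_) (++-∷ʳ-slide xs eq)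

++-concat-zipWith-∷ʳ : (xs : Vec A k) (c : Vec A n) (R : Vec (Vec A k) n) (z : A) →
                       (xs ++ concat (zipWith _∷_ c R)) ∷ʳ z ≡ concat (zipWith _∷ʳ_ (xs ∷ R) (c ∷ʳ z))
++-concat-zipWith-∷ʳ xs []      []      z = ++-∷ʳ-slide xs refl
++-concat-zipWith-∷ʳ xs (y ∷ c) (r ∷ R) z =
  ++-∷ʳ-slide xs (cong (y ∷_) (++-concat-zipWith-∷ʳ r c R z))

shift1-concat-columns : (c : Vec A n) (R : Vec (Vec A k) n) →
                        shift1 (concat (zipWith _∷_ c R)) ≡ concat (zipWith _∷ʳ_ R (shift1 c))
shift1-concat-columns []      []      = refl
shift1-concat-columns (x ∷ c) (r ∷ R) = ++-concat-zipWith-∷ʳ r c R x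

replicate-∷ʳ : (x : A) → replicate (suc n) x ≡ replicate n x ∷ʳ x
replicate-∷ʳ {n = 0}     x = refl
replicate-∷ʳ {n = suc n} x = cong (x ∷_) (replicate-∷ʳ x)

⊛-∷ʳ : (fs : Vec (A → B) n) (f : A → B) (xs : Vec A n) (x : A) →
       ((fs ∷ʳ f) ⊛ (xs ∷ʳ x)) ≡ ((fs ⊛ xs) ∷ʳ f x)
⊛-∷ʳ []       f []       x = refl
⊛-∷ʳ (g ∷ fs) f (y ∷ xs) x = cong (g y ∷_) (⊛-∷ʳ fs f xs x)

transpose-zipWith-∷ : (c : Vec A n) (R : Vec (Vec A k) n) → transpose (zipWith _∷_ c R) ≡ c ∷ transpose R
transpose-zipWith-∷ []      []      = refl
transpose-zipWith-∷ (x ∷ c) (r ∷ R) rewrite transpose-zipWith-∷ c R = refl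

transpose-zipWith-∷ʳ : (R : Vec (Vec A k) n) (c : Vec A n) → transpose (zipWith _∷ʳ_ R c) ≡ transpose R ∷ʳ c
transpose-zipWith-∷ʳ []      []      = replicate-∷ʳ []
transpose-zipWith-∷ʳ {k = k} (r ∷ R) (x ∷ c) = begin
  replicate (suc k) _∷_ ⊛ (r ∷ʳ x) ⊛ transpose (zipWith _∷ʳ_ R c)
    ≡⟨ cong₂ (λ fs cols → fs ⊛ (r ∷ʳ x) ⊛ cols) (replicate-∷ʳ _∷_) (transpose-zipWith-∷ʳ R c) ⟩
  (replicate k _∷_ ∷ʳ _∷_) ⊛ (r ∷ʳ x) ⊛ (transpose R ∷ʳ c)
    ≡⟨ cong (_⊛ (transpose R ∷ʳ c)) (⊛-∷ʳ (replicate k _∷_) _∷_ r x) ⟩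
  ((replicate k _∷_ ⊛ r) ∷ʳ (x ∷_)) ⊛ (transpose R ∷ʳ c)
    ≡⟨ ⊛-∷ʳ (replicate k _∷_ ⊛ r) (x ∷_) (transpose R) c ⟩
  (replicate k _∷_ ⊛ r ⊛ transpose R) ∷ʳ (x ∷ c)
    ∎
  where open ≡-Reasoning

tσ-concat : (p : ℕ) (t : Vec A (p * p) → B) (xss : Vec (Vec A p) p) →
            tσ p t (concat xss) ≡ t (concat (transpose xss))
tσ-concat p t xss = cong (λ yss → t (concat (transpose yss))) (group-concat xss)

zipWith-shift-zero : (xss : Vec (Vec A m) n) → zipWith shift (replicate n 0) xss ≡ xss
zipWith-shift-zero []         = refl
zipWith-shift-zero (xs ∷ xss) = cong (xs ∷_) (zipWith-shift-zero xss)

doublyCyclic-shift1-head : (p : ℕ) (t : Vec A (suc p * suc p) → B) → DoublyCyclic (suc p) t →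
                           (xs : Vec A (suc p)) (xss : Vec (Vec A (suc p)) p) →
                           t (concat (xs ∷ xss)) ≡ t (concat (shift1 xs ∷ xss))
doublyCyclic-shift1-head p t (blockwise , _) xs xss =
  trans (blockwise (xs ∷ xss) (1 ∷ replicate p 0))
        (cong (λ yss → t (concat (shift1 xs ∷ yss))) (zipWith-shift-zero xss))

lemma16 : ∀ {a b : Level} {A : Set a} {B : Set b} (p : ℕ) → 1 ≤ p →
          (t : Vec A (p * p) → B) → DoublyCyclic p t → Cyclic (p * p) (tσ p t)
lemma16 (suc q) (s≤s _) t dc@(_ , rotate-blocks) ys
  with split-first-column {n = suc q} {m = q} ys
... | c , R , refl = begin
  tσ p t (concat (zipWith _∷_ c R))
    ≡⟨ tσ-concat p t (zipWith _∷_ c R) ⟩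
  t (concat (transpose (zipWith _∷_ c R)))
    ≡⟨ cong (t ∘ concat) (transpose-zipWith-∷ c R) ⟩
  t (concat (c ∷ transpose R))
    ≡⟨ doublyCyclic-shift1-head q t dc c (transpose R) ⟩
  t (concat (shift1 c ∷ transpose R))
    ≡⟨ rotate-blocks (shift1 c ∷ transpose R) ⟩
  t (concat (transpose R ∷ʳ shift1 c))
    ≡⟨ cong (t ∘ concat) (transpose-zipWith-∷ʳ R (shift1 c)) ⟨
  t (concat (transpose (zipWith _∷ʳ_ R (shift1 c))))
    ≡⟨ tσ-concat p t (zipWith _∷ʳ_ R (shift1 c)) ⟨
  tσ p t (concat (zipWith _∷ʳ_ R (shift1 c)))
    ≡⟨ cong (tσ p t) (shift1-concat-columns c R) ⟨
  tσ p t (shift1 (concat (zipWith _∷_ c R)))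
    ∎
  where
  open ≡-Reasoning
  p = suc q
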